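{- Let $m\ge 1$. Let $P$ be a prime $m$-Dyck path and let $Q$ be any $m$-Dyck path (of positive size). Then for every integer $j$ with $1\le j\le L(P)$, the $m$-Dyck path $P\times_j Q$ is prime.
   Context: For $n\ge 1$, an $m$-Dyck path of size $n$ is a lattice path in $\mathbb R^2$ from $(0,0)$ to $(2nm,0)$ consisting of $n$ up steps $(m,m)$ and $nm$ down steps $(1,-1)$, never going below the $x$-axis. Up steps are ranked $1,\dots,n$ from left to right; a down step is at level $k$ if the last up step preceding it has rank $k$. For a path $P$ of size $n$, $L(P)$ denotes the number of down steps at level $n$ (these are the last $L(P)$ steps of $P$). For $m$-Dyck paths $P$ (size $n_1$) and $Q$ (size $n_2$) and $0\le j\le L(P)$, the $j$-th concatenation $P\times_j Q$ is the $m$-Dyck path of size $n_1+n_2$ obtained by removing the last $j$ down steps of $P$, appending (a translate of) $Q$ at that point, and then appending the $j$ removed down steps. A path $P$ is prime if there do not exist $m$-Dyck paths $Q,R$ of smaller positive sizes with $P=Q\times_0 R$. -}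

module Defs where

open import Data.Nat using (ℕ; zero; suc; _+_; _*_; _∸_; _≤_; _<_)
open import Data.List using (List; []; _∷_; _++_; length; take; drop; reverse)
open import Data.Product using (Σ; _×_; ∃-syntax)
open import Relation.Binary.PropositionalEquality using (_≡_)
open import Relation.Nullary using (¬_)

-- A step: up step (m,m) or down step (1,-1).
data Step : Set where
  U D : Step

countU : List Step → ℕ
countU []      = 0
countU (U ∷ w) = suc (countU w)
countU (D ∷ w) = countU w

countD : List Step → ℕ
countD []      = 0
countD (U ∷ w) = countD w
countD (D ∷ w) = suc (countD w)

data Above (m : ℕ) : ℕ → List Step → Set where
  done : ∀ {h} → Above m h []
  up   : ∀ {h w} → Above m (h + m) w → Above m h (U ∷ w)
  down : ∀ {h w} → Above m h w → Above m (suc h) (D ∷ w)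

record IsDyck (m n : ℕ) (w : List Step) : Set where
  field
    ups   : countU w ≡ n
    downs : countD w ≡ n * m
    above : Above m 0 w

leadD : List Step → ℕ
leadD (D ∷ w) = suc (leadD w)
leadD _       = 0

-- L(P): number of down steps at the last level = the final run of down steps
L : List Step → ℕ
L w = leadD (reverse w)

concatAt : ℕ → List Step → List Step → List Step
concatAt j P Q = take (length P ∸ j) P ++ (Q ++ drop (length P ∸ j) P)

IsPrime : (m n : ℕ) → List Step → Set
IsPrime m n P =
  IsDyck m n P ×
  ¬ (Σ ℕ λ n₁ → Σ ℕ λ n₂ → Σ (List Step) λ Q → Σ (List Step) λ R →
       1 ≤ n₁ × n₁ < n × 1 ≤ n₂ × n₂ < n ×
       IsDyck m n₁ Q × IsDyck m n₂ R × P ≡ concatAt 0 Q R)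

-- Write P = P₀ Dʲ, so that P ×ⱼ Q = P₀ Q Dʲ. The path P₀ ends at height j ≥ 1 and
-- Q, lifted to height j, never drops below j; hence a Dyck prefix A of P₀ Q Dʲ that
-- is followed by a nonempty Dyck path either lies inside P₀, where A is also a
-- Dyck prefix of P and splits P, or ends inside the final descent Dʲ, which leaves
-- no up step for the second factor.
module Submission where

open import Defs
open import Data.Nat using (ℕ; zero; suc; _+_; _*_; _≤_; _<_; z≤n; s≤s)
open import Data.Nat.Properties
  using (+-identityʳ; +-suc; +-assoc; +-commutativeSemigroup; +-cancelˡ-≡; +-cancelʳ-≡; m+n≡0⇒n≡0;
         m+n∸n≡m; m≤n+m; m<m+n; m<n+m; n≮0; ≤-refl; ≤-reflexive; ≤-trans)
open import Algebra.Properties.CommutativeSemigroup +-commutativeSemigroup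
  using (xy∙z≈xz∙y; x∙yz≈xz∙y)
open import Data.List using (List; []; _∷_; _++_; _∷ʳ_; length; take; drop; reverse; replicate)
open import Data.List.Properties
  using (++-assoc; ++-identityʳ; length-++; length-replicate; take-all; drop-all;
         reverse-++; reverse-involutive; unfold-reverse; ∷-injective)
open import Data.Product using (Σ; ∃-syntax; _×_; _,_; proj₁)
open import Data.Sum using (_⊎_; inj₁; inj₂)
open import Data.Empty using (⊥-elim)
open import Relation.Binary.PropositionalEquality
open import Relation.Nullary using (¬_)

private variable
  X : Set
  m n n₁ n₂ a b h k e e′ j : ℕ
  w xs ys A B P₀ Q R S : List Step

++-equidivisible : (xs ys zs ws : List X) → xs ++ ys ≡ zs ++ ws →
  (∃[ c ] (zs ≡ xs ++ c × c ++ ws ≡ ys)) ⊎ (∃[ c ] (xs ≡ zs ++ c × ws ≡ c ++ ys))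
++-equidivisible []       ys zs       ws eq = inj₁ (zs , refl , sym eq)
++-equidivisible (x ∷ xs) ys []       ws eq = inj₂ (x ∷ xs , refl , sym eq)
++-equidivisible (x ∷ xs) ys (z ∷ zs) ws eq with ∷-injective eq
... | refl , eq′ with ++-equidivisible xs ys zs ws eq′
...   | inj₁ (c , p , q) = inj₁ (c , cong (x ∷_) p , q)
...   | inj₂ (c , p , q) = inj₂ (c , cong (x ∷_) p , q)

take-length-++ : (xs ys : List X) → take (length xs) (xs ++ ys) ≡ xs
take-length-++ []       ys = refl
take-length-++ (x ∷ xs) ys = cong (x ∷_) (take-length-++ xs ys)

drop-length-++ : (xs ys : List X) → drop (length xs) (xs ++ ys) ≡ ys
drop-length-++ []       ys = refl
drop-length-++ (x ∷ xs) ys = drop-length-++ xs ys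

replicate-∷ʳ : ∀ n (x : X) → replicate n x ∷ʳ x ≡ x ∷ replicate n x
replicate-∷ʳ zero    x = refl
replicate-∷ʳ (suc n) x = cong (x ∷_) (replicate-∷ʳ n x)

reverse-replicate : ∀ n (x : X) → reverse (replicate n x) ≡ replicate n x
reverse-replicate zero    x = refl
reverse-replicate (suc n) x = begin
  reverse (replicate (suc n) x)  ≡⟨ unfold-reverse x (replicate n x) ⟩
  reverse (replicate n x) ∷ʳ x   ≡⟨ cong (_∷ʳ x) (reverse-replicate n x) ⟩
  replicate n x ∷ʳ x             ≡⟨ replicate-∷ʳ n x ⟩
  replicate (suc n) x            ∎
  where open ≡-Reasoning

countU-++ : ∀ xs ys → countU (xs ++ ys) ≡ countU xs + countU ys
countU-++ []       ys = refl
countU-++ (U ∷ xs) ys = cong suc (countU-++ xs ys)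
countU-++ (D ∷ xs) ys = countU-++ xs ys

countD-++ : ∀ xs ys → countD (xs ++ ys) ≡ countD xs + countD ys
countD-++ []       ys = refl
countD-++ (U ∷ xs) ys = countD-++ xs ys
countD-++ (D ∷ xs) ys = cong suc (countD-++ xs ys)

countU-replicate-D : ∀ j → countU (replicate j D) ≡ 0
countU-replicate-D zero    = refl
countU-replicate-D (suc j) = countU-replicate-D j

countD-replicate-D : ∀ j → countD (replicate j D) ≡ j
countD-replicate-D zero    = refl
countD-replicate-D (suc j) = cong suc (countD-replicate-D j)

countU-insert : ∀ xs ys zs → countU (xs ++ zs ++ ys) ≡ countU (xs ++ ys) + countU zs
countU-insert xs ys zs = begin
  countU (xs ++ zs ++ ys)                ≡⟨ countU-++ xs (zs ++ ys) ⟩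
  countU xs + countU (zs ++ ys)          ≡⟨ cong (countU xs +_) (countU-++ zs ys) ⟩
  countU xs + (countU zs + countU ys)    ≡⟨ x∙yz≈xz∙y (countU xs) (countU zs) (countU ys) ⟩
  countU xs + countU ys + countU zs      ≡⟨ cong (_+ countU zs) (countU-++ xs ys) ⟨
  countU (xs ++ ys) + countU zs          ∎
  where open ≡-Reasoning

leadD-replicate : ∀ j w → j ≤ leadD w → w ≡ replicate j D ++ drop j w
leadD-replicate zero    w       _         = refl
leadD-replicate (suc j) (D ∷ w) (s≤s j≤l) = cong (D ∷_) (leadD-replicate j w j≤l)

L-suffix : ∀ j P → j ≤ L P → ∃[ P₀ ] P ≡ P₀ ++ replicate j D
L-suffix j P j≤L = reverse (drop j (reverse P)) , (begin
  P                                                    ≡⟨ reverse-involutive P ⟨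
  reverse (reverse P)                                  ≡⟨ cong reverse (leadD-replicate j (reverse P) j≤L) ⟩
  reverse (replicate j D ++ drop j (reverse P))        ≡⟨ reverse-++ (replicate j D) _ ⟩
  reverse (drop j (reverse P)) ++ reverse (replicate j D)
                                                       ≡⟨ cong (reverse (drop j (reverse P)) ++_) (reverse-replicate j D) ⟩
  reverse (drop j (reverse P)) ++ replicate j D        ∎)
  where open ≡-Reasoning

concatAt-zero : ∀ P Q → concatAt 0 P Q ≡ P ++ Q
concatAt-zero P Q
  rewrite take-all (length P) P ≤-refl | drop-all (length P) P ≤-refl = cong (P ++_) (++-identityʳ Q)

concatAt-suffix : ∀ P₀ S Q → length S ≡ j → concatAt j (P₀ ++ S) Q ≡ P₀ ++ Q ++ S
concatAt-suffix P₀ S Q refl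
  rewrite length-++ P₀ {S} | m+n∸n≡m (length P₀) (length S)
  = cong₂ _++_ (take-length-++ P₀ S) (cong (Q ++_) (drop-length-++ P₀ S))

data Walk (m : ℕ) : ℕ → List Step → ℕ → Set where
  done : Walk m h [] h
  up   : Walk m (h + m) w e → Walk m h (U ∷ w) e
  down : Walk m h w e → Walk m (suc h) (D ∷ w) e

Above⇒Walk : Above m h w → ∃[ e ] Walk m h w e
Above⇒Walk done     = _ , done
Above⇒Walk (up a)   = let e , W = Above⇒Walk a in e , up W
Above⇒Walk (down a) = let e , W = Above⇒Walk a in e , down W

Walk⇒Above : Walk m h w e → Above m h w
Walk⇒Above done     = done
Walk⇒Above (up W)   = up (Walk⇒Above W)
Walk⇒Above (down W) = down (Walk⇒Above W)

Walk-balance : Walk m h w e → e + countD w ≡ h + countU w * m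
Walk-balance {h = h} done = trans (+-identityʳ h) (sym (+-identityʳ h))
Walk-balance {m} {h} (up W) = trans (Walk-balance W) (+-assoc h m _)
Walk-balance {e = e} (down {w = w} W) = trans (+-suc e (countD w)) (cong suc (Walk-balance W))

Walk-functional : Walk m h w e → Walk m h w e′ → e ≡ e′
Walk-functional done     done     = refl
Walk-functional (up W)   (up V)   = Walk-functional W V
Walk-functional (down W) (down V) = Walk-functional W V

Walk-++⁻ : ∀ xs → Walk m h (xs ++ ys) e → ∃[ k ] (Walk m h xs k × Walk m k ys e)
Walk-++⁻ []       W        = _ , done , W
Walk-++⁻ (U ∷ xs) (up W)   = let k , V , V′ = Walk-++⁻ xs W in k , up V , V′
Walk-++⁻ (D ∷ xs) (down W) = let k , V , V′ = Walk-++⁻ xs W in k , down V , V′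

Walk-++⁺ : Walk m h xs k → Walk m k ys e → Walk m h (xs ++ ys) e
Walk-++⁺ done     V = V
Walk-++⁺ (up W)   V = up (Walk-++⁺ W V)
Walk-++⁺ (down W) V = down (Walk-++⁺ W V)

Walk-raise : ∀ c → Walk m h w e → Walk m (h + c) w (e + c)
Walk-raise c done = done
Walk-raise {m} {h} c (up {w = w} {e = e} W) =
  up (subst (λ h′ → Walk m h′ w (e + c)) (xy∙z≈xz∙y h m c) (Walk-raise c W))
Walk-raise c (down W) = down (Walk-raise c W)

Walk-replicate-D-start : ∀ j → Walk m h (replicate j D) e → h ≡ j + e
Walk-replicate-D-start zero    done     = refl
Walk-replicate-D-start (suc j) (down W) = cong suc (Walk-replicate-D-start j W)

Walk-closed-countU-pos : Walk m h w h → 1 ≤ countD w → 1 ≤ countU w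
Walk-closed-countU-pos {h = h} {w} W 1≤d with countU w | +-cancelˡ-≡ h _ _ (Walk-balance W)
... | zero  | d≡0 = ⊥-elim (n≮0 (subst (1 ≤_) d≡0 1≤d))
... | suc _ | _   = s≤s z≤n

IsDyck⇒Walk : IsDyck m n w → Walk m 0 w 0
IsDyck⇒Walk {m} {n} {w} d with Above⇒Walk (IsDyck.above d)
... | e , W = subst (Walk m 0 w) e≡0 W
  where
  e≡0 : e ≡ 0
  e≡0 = +-cancelʳ-≡ (countD w) e 0
          (trans (Walk-balance W) (trans (cong (_* m) (IsDyck.ups d)) (sym (IsDyck.downs d))))

Walk⇒IsDyck : countU w ≡ n → Walk m 0 w 0 → IsDyck m n w
Walk⇒IsDyck {m = m} eq W = record
  { ups   = eq
  ; downs = trans (Walk-balance W) (cong (_* m) eq)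
  ; above = Walk⇒Above W
  }

IsDyck-insert : ∀ P₀ → IsDyck m n₁ (P₀ ++ S) → IsDyck m n₂ Q → IsDyck m (n₁ + n₂) (P₀ ++ Q ++ S)
IsDyck-insert {S = S} {Q = Q} P₀ dP dQ with Walk-++⁻ P₀ (IsDyck⇒Walk dP)
... | k , WP₀ , WS =
  Walk⇒IsDyck (trans (countU-insert P₀ S Q) (cong₂ _+_ (IsDyck.ups dP) (IsDyck.ups dQ)))
              (Walk-++⁺ WP₀ (Walk-++⁺ (Walk-raise k (IsDyck⇒Walk dQ)) WS))

IsDyck⇒Walk-beforeDescent : ∀ j → IsDyck m n (P₀ ++ replicate j D) → Walk m 0 P₀ j
IsDyck⇒Walk-beforeDescent {m} {P₀ = P₀} j d with Walk-++⁻ P₀ (IsDyck⇒Walk d)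
... | k , WP₀ , WD = subst (Walk m 0 P₀) (trans (Walk-replicate-D-start j WD) (+-identityʳ j)) WP₀

Factorisation : (m n : ℕ) → List Step → Set
Factorisation m n P =
  Σ ℕ λ n₁ → Σ ℕ λ n₂ → Σ (List Step) λ Q → Σ (List Step) λ R →
    1 ≤ n₁ × n₁ < n × 1 ≤ n₂ × n₂ < n ×
    IsDyck m n₁ Q × IsDyck m n₂ R × P ≡ concatAt 0 Q R

factorisation : 1 ≤ a → 1 ≤ b → IsDyck m a A → IsDyck m b B → Factorisation m (a + b) (A ++ B)
factorisation {a} {b} {A = A} {B = B} 1≤a 1≤b dA dB =
  a , b , A , B , 1≤a , m<m+n a 1≤b , 1≤b , m<n+m b 1≤a , dA , dB , sym (concatAt-zero A B)

prefix⇒Factorisation : IsDyck m n (A ++ R) → IsDyck m a A → 1 ≤ a → 1 ≤ countD R →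
                       Factorisation m n (A ++ R)
prefix⇒Factorisation {m} {n} {A} {R} {a} dP dA 1≤a 1≤d with Walk-++⁻ A (IsDyck⇒Walk dP)
... | k , WA , WR with Walk-functional WA (IsDyck⇒Walk dA)
... | refl = subst (λ n → Factorisation m n (A ++ R)) size
               (factorisation 1≤a (Walk-closed-countU-pos WR 1≤d) dA (Walk⇒IsDyck refl WR))
  where
  size : a + countU R ≡ n
  size = trans (cong (_+ countU R) (sym (IsDyck.ups dA)))
               (trans (sym (countU-++ A R)) (IsDyck.ups dP))

-- Lifted by j, the closed walk Q never reaches height 0, so xs must end inside Dʲ.
return-in-descent : 1 ≤ j → Walk m 0 Q 0 → Walk m j xs 0 → xs ++ ys ≡ Q ++ replicate j D →
                    countU ys ≡ 0
return-in-descent {j} {Q = Q} {xs = xs} {ys = ys} 1≤j WQ Wxs eq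
  with ++-equidivisible xs ys Q (replicate j D) eq
... | inj₁ (c , refl , _) with k , Wxs′ , _ ← Walk-++⁻ xs WQ =
  ⊥-elim (k+j≢0 (Walk-functional (Walk-raise j Wxs′) Wxs))
  where
  k+j≢0 : k + j ≢ 0
  k+j≢0 k+j≡0 = n≮0 (subst (1 ≤_) (m+n≡0⇒n≡0 k k+j≡0) 1≤j)
... | inj₂ (c , _ , Dʲ≡c++ys) = m+n≡0⇒n≡0 (countU c) (begin
  countU c + countU ys   ≡⟨ countU-++ c ys ⟨
  countU (c ++ ys)       ≡⟨ cong countU Dʲ≡c++ys ⟨
  countU (replicate j D) ≡⟨ countU-replicate-D j ⟩
  0                      ∎)
  where open ≡-Reasoning

insert-irreducible : 1 ≤ j → IsPrime m n₁ (P₀ ++ replicate j D) → IsDyck m n₂ Q →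
                     ¬ Factorisation m (n₁ + n₂) (P₀ ++ Q ++ replicate j D)
insert-irreducible {j} {m} {n₁} {P₀ = P₀} {Q = Q} 1≤j (dP , P-irreducible) dQ
                   (_ , b , A , B , 1≤a , _ , 1≤b , _ , dA , dB , eq)
  with ++-equidivisible P₀ (Q ++ replicate j D) A B (trans eq (concatAt-zero A B))
... | inj₁ (c , refl , c++B≡QDʲ) with k , WP₀ , Wc ← Walk-++⁻ P₀ (IsDyck⇒Walk dA)
                                 with refl ← Walk-functional WP₀ (IsDyck⇒Walk-beforeDescent j dP) =
  n≮0 (subst (1 ≤_) B-flat 1≤b)
  where
  B-flat : b ≡ 0
  B-flat = trans (sym (IsDyck.ups dB)) (return-in-descent 1≤j (IsDyck⇒Walk dQ) Wc c++B≡QDʲ)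
... | inj₂ (c , refl , refl) =
  P-irreducible (subst (Factorisation m n₁) (sym reassoc)
            (prefix⇒Factorisation (subst (IsDyck m n₁) reassoc dP) dA 1≤a descends))
  where
  reassoc : (A ++ c) ++ replicate j D ≡ A ++ c ++ replicate j D
  reassoc = ++-assoc A c (replicate j D)
  descends : 1 ≤ countD (c ++ replicate j D)
  descends = ≤-trans 1≤j (≤-trans (m≤n+m j (countD c)) (≤-reflexive (sym countD-cDʲ)))
    where
    countD-cDʲ : countD (c ++ replicate j D) ≡ countD c + j
    countD-cDʲ = trans (countD-++ c (replicate j D)) (cong (countD c +_) (countD-replicate-D j))

lemma2p6 : (m n₁ n₂ : ℕ) → 1 ≤ m → 1 ≤ n₁ → 1 ≤ n₂ →
           (P Q : List Step) → IsPrime m n₁ P → IsDyck m n₂ Q →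
           (j : ℕ) → 1 ≤ j → j ≤ L P →
           IsPrime m (n₁ + n₂) (concatAt j P Q)
lemma2p6 m n₁ n₂ _ _ _ P Q P-prime dQ j 1≤j j≤L with P₀ , refl ← L-suffix j P j≤L =
  subst (IsPrime m (n₁ + n₂)) (sym (concatAt-suffix P₀ (replicate j D) Q (length-replicate j)))
        (IsDyck-insert P₀ (proj₁ P-prime) dQ , insert-irreducible 1≤j P-prime dQ)
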